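{- Let $n$ be a positive integer and $s\in\{1,2\}$, and consider the polynomial in $a$ $$G_s(a)=2n^2+na-a^2+\tfrac12 n(n-1)(s-s^2)-(n-1)as$$ (this is the second factor in $\nu(S)=\big(na+\tfrac12n(n-1)s\big)G_s(a)$, where $S$ is the sequence consisting of $n$ copies of $n$ together with $a,a+s,\dots,a+(n-1)s$). Then: (i) for $s=1$, $G_1(a)$ is divisible by $a-h$ for some positive integer $h$ if and only if $n^2$ is a triangular number; (ii) for $s=2$, $G_2(a)$ is divisible by $a-h$ for some positive integer $h$ if and only if $n=F_{2k}$ for some positive integer $k$, and in this case $h=F_{2k-1}+1$.
   Context: $F_k$ denotes the Fibonacci numbers, $F_1=F_2=1$, $F_{k+1}=F_k+F_{k-1}$. A triangular number is a number of the form $k(k+1)/2$ with $k$ a positive integer. For a finite sequence $(b_1,\dots,b_N)$, $\nu(b_1,\dots,b_N)=\big(\sum b_i\big)^2-\sum b_i^3$. -}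

module Defs where

open import Data.Nat as ℕ using (ℕ; zero; suc; _∸_)
open import Data.Nat.DivMod using (_/_)
open import Data.Integer using (ℤ; +_; _+_; _-_; _*_; 0ℤ)
open import Data.List using (List; []; _∷_)
open import Data.Product using (Σ; ∃; _×_)
open import Relation.Binary.PropositionalEquality using (_≡_)

fib : ℕ → ℕ
fib zero = zero
fib (suc zero) = suc zero
fib (suc (suc k)) = fib (suc k) ℕ.+ fib k

IsTriangular : ℕ → Set
IsTriangular m = Σ ℕ λ k → (1 ℕ.≤ k) × (m ≡ (k ℕ.* suc k) / 2)

-- Integer polynomials as coefficient lists (constant term first), Horner evaluation.
Poly : Set
Poly = List ℤ

eval : Poly → ℤ → ℤ
eval [] a = 0ℤ
eval (c ∷ cs) a = c + a * eval cs a

DivisibleByLinear : (ℤ → ℤ) → ℤ → Set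
DivisibleByLinear p h = Σ Poly λ q → ∀ (a : ℤ) → p a ≡ (a - h) * eval q a

-- G_s(a) = 2n^2 + n a - a^2 + (1/2) n (n-1) (s - s^2) - (n-1) a s
-- (n(n-1)/2 is an integer, computed exactly by natural-number division).
G : ℕ → ℕ → ℤ → ℤ
G n s a =
  (+ 2) * (+ n) * (+ n) + (+ n) * a - a * a
  + (+ ((n ℕ.* (n ∸ 1)) / 2)) * ((+ s) - (+ s) * (+ s))
  - ((+ n) - (+ 1)) * a * (+ s)

-- Dividing G_s(a) by a - h leaves a remainder depending only on n and h, so a - h divides G_s
-- exactly when that remainder vanishes.  For s = 1 this says 2n² = (h-1)h, i.e. n² is the
-- triangular number T_{h-1}.  For s = 2, writing h = g + 1, it is the Cassini-type equation
-- n² + 1 = g² + ng, whose positive solutions are exactly (n, g) = (F_{2k}, F_{2k-1}): the map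
-- (n, g) ↦ (2n + g, n + g) preserves the equation and generates these pairs from (1, 1),
-- and every other solution descends along its inverse.  The root h is unique because
-- g² + ng is strictly increasing in g.
module Submission where

open import Defs
open import Data.Nat using (ℕ; _≤_; _*_; _+_; _∸_)
open import Data.Integer using (+_)
open import Data.Product using (Σ; _×_)
open import Function.Bundles using (_⇔_)
open import Relation.Binary.PropositionalEquality using (_≡_)

open import Data.Nat using (zero; suc; s≤s; z≤n; _<_; compare; less; equal; greater)
open import Relation.Binary.Definitions using (tri<; tri≈; tri>)
open import Data.Nat.Properties
  using ( +-cancelˡ-≡; +-cancelʳ-≡; +-comm; *-comm; *-suc; m*n≡1⇒n≡1; m≢1+m+n; m<m+n
        ; <-cmp; <-irrefl; <⇒≤; +-mono-<-≤; *-mono-<; *-monoʳ-≤; <-≤-trans; m≤m+n; +-suc)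
  renaming (+-identityʳ to +-identityʳℕ)
open import Data.Nat.Divisibility using (_∣_; ∣m∣n⇒∣m+n; m∣m*n)
open import Data.Nat.DivMod using (_/_; m*n/n≡m; m*[n/m]≡n)
open import Data.Nat.Induction using (<-wellFounded)
import Data.Nat.Tactic.RingSolver as ℕ-Solver
open import Data.Integer using (ℤ; 0ℤ; _-_; -_) renaming (_+_ to _+ℤ_; _*_ to _*ℤ_)
open import Data.Integer.Properties
  using (+-identityʳ; +-identityˡ; +-inverseʳ; *-zeroˡ; pos-+; pos-*; +-injective; i-j≡0⇒i≡j; i≡j⇒i-j≡0)
import Data.Integer.Tactic.RingSolver as ℤ-Solver
open import Data.List using (_∷_; [])
open import Data.Product using (∃; ∃₂; _,_; proj₁; proj₂)
open import Data.Empty using (⊥-elim)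
open import Data.Sum using (_⊎_; inj₁; inj₂)
open import Function.Bundles using (mk⇔; Equivalence)
open import Function.Properties.Equivalence using () renaming (trans to ⇔-trans)
open import Induction.WellFounded using (Acc; acc)
open import Relation.Binary.PropositionalEquality using (refl; sym; trans; cong; cong₂; subst; subst₂; module ≡-Reasoning)

open Equivalence

2∣m*[1+m] : ∀ m → 2 ∣ m * suc m
2∣m*[1+m] zero = m∣m*n 0
2∣m*[1+m] (suc m) = subst (2 ∣_) (expand m) (∣m∣n⇒∣m+n (2∣m*[1+m] m) (m∣m*n {2} (suc m)))
  where
  expand : ∀ m → m * suc m + 2 * suc m ≡ suc m * suc (suc m)
  expand = ℕ-Solver.solve-∀

2∣m*[m∸1] : ∀ m → 2 ∣ m * (m ∸ 1)
2∣m*[m∸1] zero = m∣m*n 0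
2∣m*[m∸1] (suc m) = subst (2 ∣_) (*-comm m (suc m)) (2∣m*[1+m] m)

≡/2⇔2*≡ : ∀ {m x} → 2 ∣ x → m ≡ x / 2 ⇔ 2 * m ≡ x
≡/2⇔2*≡ {m} {x} 2∣x = mk⇔
  (λ m≡x/2 → trans (cong (2 *_) m≡x/2) (m*[n/m]≡n 2∣x))
  (λ 2m≡x → trans (sym (m*n/n≡m m 2)) (cong (_/ 2) (trans (*-comm m 2) 2m≡x)))

divisibleByLinear⇔remainder≡0 : ∀ {p : ℤ → ℤ} {h : ℤ} q r →
  (∀ a → p a ≡ (a - h) *ℤ eval q a +ℤ r) → DivisibleByLinear p h ⇔ r ≡ 0ℤ
divisibleByLinear⇔remainder≡0 {p} {h} q r p≡ = mk⇔ remainder≡0 (λ r≡0 → q , divides r≡0)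
  where
  open ≡-Reasoning
  vanishesAt-h : ∀ s → (h - h) *ℤ s ≡ 0ℤ
  vanishesAt-h s = trans (cong (_*ℤ s) (+-inverseʳ h)) (*-zeroˡ s)

  remainder≡0 : DivisibleByLinear p h → r ≡ 0ℤ
  remainder≡0 (q′ , p≡′) = begin
    r                              ≡⟨ sym (+-identityˡ r) ⟩
    0ℤ +ℤ r                        ≡⟨ cong (_+ℤ r) (sym (vanishesAt-h (eval q h))) ⟩
    (h - h) *ℤ eval q h +ℤ r       ≡⟨ sym (p≡ h) ⟩
    p h                            ≡⟨ p≡′ h ⟩
    (h - h) *ℤ eval q′ h           ≡⟨ vanishesAt-h (eval q′ h) ⟩
    0ℤ                             ∎

  divides : r ≡ 0ℤ → ∀ a → p a ≡ (a - h) *ℤ eval q a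
  divides r≡0 a = trans (p≡ a) (trans (cong ((a - h) *ℤ eval q a +ℤ_) r≡0) (+-identityʳ _))

+m-+n≡0⇔m≡n : ∀ m n → + m - + n ≡ 0ℤ ⇔ m ≡ n
+m-+n≡0⇔m≡n m n = mk⇔ (λ eq → +-injective (i-j≡0⇒i≡j _ _ eq)) (λ m≡n → i≡j⇒i-j≡0 (cong +_ m≡n))

quotient₁ : ℕ → Poly
quotient₁ k = - + k ∷ - + 1 ∷ []

quotient₂ : ℕ → ℕ → Poly
quotient₂ n g = + 1 - + n - + g ∷ - + 1 ∷ []

G₁-divMod : ∀ n k a →
  G n 1 a ≡ (a - + suc k) *ℤ eval (quotient₁ k) a +ℤ (+ (2 * (n * n)) - + (k * suc k))
G₁-divMod n k a = trans (identity (+ n) (+ k) (+ (n * (n ∸ 1) / 2)) a)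
  (cong (λ r → (a - + suc k) *ℤ eval (quotient₁ k) a +ℤ r)
    (sym (cong₂ _-_ (trans (pos-* 2 (n * n)) (cong (+ 2 *ℤ_) (pos-* n n))) (pos-* k (suc k)))))
  where
  identity : ∀ N K T a →
    + 2 *ℤ N *ℤ N +ℤ N *ℤ a - a *ℤ a +ℤ T *ℤ (+ 1 - + 1 *ℤ + 1) - (N - + 1) *ℤ a *ℤ + 1
      ≡ (a - (+ 1 +ℤ K)) *ℤ (- K +ℤ a *ℤ (- + 1 +ℤ a *ℤ 0ℤ))
        +ℤ (+ 2 *ℤ (N *ℤ N) - K *ℤ (+ 1 +ℤ K))
  identity = ℤ-Solver.solve-∀

G₂-divMod : ∀ n g a →
  G n 2 a ≡ (a - + suc g) *ℤ eval (quotient₂ n g) a +ℤ (+ (n * n + 1) - + (g * g + n * g))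
G₂-divMod n g a = begin
  G n 2 a                                   ≡⟨ identity N (+ g) (+ t) a ⟩
  Q +ℤ D +ℤ (N *ℤ N - (+ 2 *ℤ + t +ℤ N))    ≡⟨ cong (λ z → Q +ℤ D +ℤ (N *ℤ N - z)) 2t+n≡n*n ⟩
  Q +ℤ D +ℤ (N *ℤ N - N *ℤ N)               ≡⟨ cong (Q +ℤ D +ℤ_) (+-inverseʳ (N *ℤ N)) ⟩
  Q +ℤ D +ℤ 0ℤ                              ≡⟨ +-identityʳ (Q +ℤ D) ⟩
  Q +ℤ D                                    ≡⟨ cong (Q +ℤ_) (cong₂ _-_ (sym +[n*n+1]) (sym +[g*g+n*g])) ⟩
  Q +ℤ (+ (n * n + 1) - + (g * g + n * g))  ∎
  where
  open ≡-Reasoning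
  N : ℤ
  N = + n
  t : ℕ
  t = n * (n ∸ 1) / 2
  Q D : ℤ
  Q = (a - + suc g) *ℤ eval (quotient₂ n g) a
  D = (N *ℤ N +ℤ + 1) - (+ g *ℤ + g +ℤ N *ℤ + g)

  +[n*n+1] : + (n * n + 1) ≡ N *ℤ N +ℤ + 1
  +[n*n+1] = trans (pos-+ (n * n) 1) (cong (_+ℤ + 1) (pos-* n n))

  +[g*g+n*g] : + (g * g + n * g) ≡ + g *ℤ + g +ℤ N *ℤ + g
  +[g*g+n*g] = trans (pos-+ (g * g) (n * g)) (cong₂ _+ℤ_ (pos-* g g) (pos-* n g))

  n*[n∸1]+n≡n*n : ∀ n → n * (n ∸ 1) + n ≡ n * n
  n*[n∸1]+n≡n*n zero = refl
  n*[n∸1]+n≡n*n (suc m) = expand m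
    where
    expand : ∀ m → suc m * m + suc m ≡ suc m * suc m
    expand = ℕ-Solver.solve-∀

  -- t is a truncated ℕ-quotient; it is exact because n(n-1) is even.
  2t+n≡n*n : + 2 *ℤ + t +ℤ N ≡ N *ℤ N
  2t+n≡n*n = begin
    + 2 *ℤ + t +ℤ + n       ≡⟨ cong (_+ℤ + n) (sym (pos-* 2 t)) ⟩
    + (2 * t) +ℤ + n        ≡⟨ sym (pos-+ (2 * t) n) ⟩
    + (2 * t + n)           ≡⟨ cong (λ z → + (z + n)) (m*[n/m]≡n (2∣m*[m∸1] n)) ⟩
    + (n * (n ∸ 1) + n)     ≡⟨ cong +_ (n*[n∸1]+n≡n*n n) ⟩
    + (n * n)               ≡⟨ pos-* n n ⟩
    + n *ℤ + n              ∎

  identity : ∀ N g T a →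
    + 2 *ℤ N *ℤ N +ℤ N *ℤ a - a *ℤ a +ℤ T *ℤ (+ 2 - + 2 *ℤ + 2) - (N - + 1) *ℤ a *ℤ + 2
      ≡ (a - (+ 1 +ℤ g)) *ℤ ((+ 1 - N - g) +ℤ a *ℤ (- + 1 +ℤ a *ℤ 0ℤ))
        +ℤ ((N *ℤ N +ℤ + 1) - (g *ℤ g +ℤ N *ℤ g)) +ℤ (N *ℤ N - (+ 2 *ℤ T +ℤ N))
  identity = ℤ-Solver.solve-∀

G₁-divisible⇔ : ∀ n k → DivisibleByLinear (G n 1) (+ suc k) ⇔ 2 * (n * n) ≡ k * suc k
G₁-divisible⇔ n k = ⇔-trans
  (divisibleByLinear⇔remainder≡0 (quotient₁ k) _ (G₁-divMod n k))
  (+m-+n≡0⇔m≡n (2 * (n * n)) (k * suc k))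

Cassini : ℕ → ℕ → Set
Cassini n g = n * n + 1 ≡ g * g + n * g

G₂-divisible⇔ : ∀ n g → DivisibleByLinear (G n 2) (+ suc g) ⇔ Cassini n g
G₂-divisible⇔ n g = ⇔-trans
  (divisibleByLinear⇔remainder≡0 (quotient₂ n g) _ (G₂-divMod n g))
  (+m-+n≡0⇔m≡n (n * n + 1) (g * g + n * g))

cassini-step⇔ : ∀ n g → Cassini n g ⇔ Cassini (n + n + g) (n + g)
cassini-step⇔ n g = mk⇔
  (λ c → trans (left n g) (trans (cong (_+ δ) c) (sym (right n g))))
  (λ c′ → +-cancelʳ-≡ δ _ _ (trans (sym (left n g)) (trans c′ (right n g))))
  where
  δ : ℕ
  δ = 3 * n * n + 4 * n * g + g * g
  left : ∀ n g → (n + n + g) * (n + n + g) + 1 ≡ (n * n + 1) + (3 * n * n + 4 * n * g + g * g)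
  left = ℕ-Solver.solve-∀
  right : ∀ n g → (n + g) * (n + g) + (n + n + g) * (n + g)
                  ≡ (g * g + n * g) + (3 * n * n + 4 * n * g + g * g)
  right = ℕ-Solver.solve-∀

fib-pair-step : ∀ j → fib (2 + 2 * suc j) ≡ fib (2 + 2 * j) + fib (2 + 2 * j) + fib (1 + 2 * j)
               × fib (1 + 2 * suc j) ≡ fib (2 + 2 * j) + fib (1 + 2 * j)
fib-pair-step j =
  trans (cong (λ m → fib (2 + m)) (*-suc 2 j)) ([a+b]+a≡a+a+b (fib (2 + 2 * j)) (fib (1 + 2 * j))) ,
  cong (λ m → fib (1 + m)) (*-suc 2 j)
  where
  [a+b]+a≡a+a+b : ∀ a b → (a + b) + a ≡ a + a + b
  [a+b]+a≡a+a+b = ℕ-Solver.solve-∀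

cassini-fib : ∀ j → Cassini (fib (2 + 2 * j)) (fib (1 + 2 * j))
cassini-fib zero = refl
cassini-fib (suc j) = subst₂ Cassini (sym (proj₁ (fib-pair-step j))) (sym (proj₂ (fib-pair-step j)))
  (to (cassini-step⇔ (fib (2 + 2 * j)) (fib (1 + 2 * j))) (cassini-fib j))

-- g ≥ n forces n = g = 1 and 2g < n makes n² + 1 too large; otherwise (n, g) is the
-- cassini-step image of (n - g, 2g - n).
cassini-descent : ∀ {n g} → 1 ≤ n → Cassini n g →
  (n ≡ 1 × g ≡ 1) ⊎ ∃₂ λ n′ g′ → 1 ≤ n′ × n ≡ n′ + n′ + g′ × g ≡ n′ + g′
cassini-descent {n} {g} 1≤n c with compare g n
... | equal .n = inj₁ (n≡1 , n≡1)
  where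
  n≡1 : n ≡ 1
  n≡1 = m*n≡1⇒n≡1 n n (sym (+-cancelˡ-≡ (n * n) 1 (n * n) c))
cassini-descent {suc m} _ c | greater .(suc m) d = ⊥-elim (m≢1+m+n _ (trans c (excess m d)))
  where
  excess : ∀ m d → let g = suc (suc m + d) in
    g * g + suc m * g ≡ suc ((suc m * suc m + 1) + (m * m + d * d + 3 * m * d + 5 * m + 5 * d + 3))
  excess = ℕ-Solver.solve-∀
... | less .g e with compare g (suc e)
...   | less .g k = ⊥-elim (m≢1+m+n _ (trans (sym c) (deficit g k)))
  where
  deficit : ∀ g k → let n = suc (g + (g + k)) in
    n * n + 1 ≡ suc ((g * g + n * g) + suc (g * g + k * k + 3 * g + 2 * k + 3 * g * k))
  deficit = ℕ-Solver.solve-∀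
...   | equal .(suc e) = inj₂ (suc e , 0 , s≤s z≤n , shape e , sym (+-identityʳℕ (suc e)))
  where
  shape : ∀ e → suc (suc e + e) ≡ suc e + suc e + 0
  shape = ℕ-Solver.solve-∀
...   | greater .(suc e) k = inj₂ (suc e , suc k , s≤s z≤n , shape e k , sym (+-suc (suc e) k))
  where
  shape : ∀ e k → suc (suc (suc e + k) + e) ≡ suc e + suc e + suc k
  shape = ℕ-Solver.solve-∀

cassini⇒fib : ∀ {n g} → 1 ≤ n → Cassini n g → ∃ λ j → n ≡ fib (2 + 2 * j) × g ≡ fib (1 + 2 * j)
cassini⇒fib {n} = descend (<-wellFounded n)
  where
  descend : ∀ {n g} → Acc _<_ n → 1 ≤ n → Cassini n g → ∃ λ j → n ≡ fib (2 + 2 * j) × g ≡ fib (1 + 2 * j)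
  descend {n} {g} (acc smaller) 1≤n c with cassini-descent 1≤n c
  ... | inj₁ (refl , refl) = 0 , refl , refl
  ... | inj₂ (n′ , g′ , 1≤n′ , refl , refl)
    with descend (smaller (<-≤-trans (m<m+n n′ 1≤n′) (m≤m+n (n′ + n′) g′))) 1≤n′ (from (cassini-step⇔ n′ g′) c)
  ...   | j , refl , refl = suc j , sym (proj₁ (fib-pair-step j)) , sym (proj₂ (fib-pair-step j))

x²+nx-mono-< : ∀ n {x y} → x < y → x * x + n * x < y * y + n * y
x²+nx-mono-< n x<y = +-mono-<-≤ (*-mono-< x<y x<y) (*-monoʳ-≤ n (<⇒≤ x<y))

cassini-unique : ∀ n {g g′} → Cassini n g → Cassini n g′ → g ≡ g′
cassini-unique n {g} {g′} c c′ with <-cmp g g′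
... | tri< g<g′ _ _ = ⊥-elim (<-irrefl (trans (sym c) c′) (x²+nx-mono-< n g<g′))
... | tri≈ _ g≡g′ _ = g≡g′
... | tri> _ _ g′<g = ⊥-elim (<-irrefl (trans (sym c′) c) (x²+nx-mono-< n g′<g))

fib-2*suc : ∀ j → fib (2 * suc j) ≡ fib (2 + 2 * j) × fib (2 * suc j ∸ 1) ≡ fib (1 + 2 * j)
fib-2*suc j = cong fib (*-suc 2 j) , cong (λ m → fib (m ∸ 1)) (*-suc 2 j)

cassini-fib-2*suc : ∀ j → Cassini (fib (2 * suc j)) (fib (2 * suc j ∸ 1))
cassini-fib-2*suc j = subst₂ Cassini (sym (proj₁ (fib-2*suc j))) (sym (proj₂ (fib-2*suc j))) (cassini-fib j)

G₁-root⇔triangular : ∀ n → 1 ≤ n →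
  (Σ ℕ λ h → (1 ≤ h) × DivisibleByLinear (G n 1) (+ h)) ⇔ IsTriangular (n * n)
G₁-root⇔triangular (suc m) _ = mk⇔ toTriangular fromTriangular
  where
  n = suc m

  toTriangular : (Σ ℕ λ h → (1 ≤ h) × DivisibleByLinear (G n 1) (+ h)) → IsTriangular (n * n)
  toTriangular (suc k , _ , div) with k | to (G₁-divisible⇔ n k) div
  ... | suc k′ | 2n²≡k[k+1] = suc k′ , s≤s z≤n , from (≡/2⇔2*≡ (2∣m*[1+m] (suc k′))) 2n²≡k[k+1]

  fromTriangular : IsTriangular (n * n) → Σ ℕ λ h → (1 ≤ h) × DivisibleByLinear (G n 1) (+ h)
  fromTriangular (k , _ , n²≡k[k+1]/2) =
    suc k , s≤s z≤n , from (G₁-divisible⇔ n k) (to (≡/2⇔2*≡ (2∣m*[1+m] k)) n²≡k[k+1]/2)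

G₂-root⇔evenFib : ∀ n → 1 ≤ n →
  (Σ ℕ λ h → (1 ≤ h) × DivisibleByLinear (G n 2) (+ h)) ⇔ (Σ ℕ λ k → (1 ≤ k) × (n ≡ fib (2 * k)))
G₂-root⇔evenFib n 1≤n = mk⇔ toEvenFib fromEvenFib
  where
  toEvenFib : (Σ ℕ λ h → (1 ≤ h) × DivisibleByLinear (G n 2) (+ h)) → Σ ℕ λ k → (1 ≤ k) × (n ≡ fib (2 * k))
  toEvenFib (suc g , _ , div) with cassini⇒fib 1≤n (to (G₂-divisible⇔ n g) div)
  ... | j , n≡F , _ = suc j , s≤s z≤n , trans n≡F (sym (proj₁ (fib-2*suc j)))

  fromEvenFib : (Σ ℕ λ k → (1 ≤ k) × (n ≡ fib (2 * k))) → Σ ℕ λ h → (1 ≤ h) × DivisibleByLinear (G n 2) (+ h)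
  fromEvenFib (suc j , _ , n≡F) = suc (fib (2 * suc j ∸ 1)) , s≤s z≤n ,
    from (G₂-divisible⇔ n (fib (2 * suc j ∸ 1))) (subst (λ m → Cassini m _) (sym n≡F) (cassini-fib-2*suc j))

G₂-root-unique : ∀ n h k → 1 ≤ h → DivisibleByLinear (G n 2) (+ h) → 1 ≤ k → n ≡ fib (2 * k) →
  h ≡ fib (2 * k ∸ 1) + 1
G₂-root-unique n (suc g) (suc j) _ div _ n≡F =
  trans (cong suc (cassini-unique n (to (G₂-divisible⇔ n g) div) cassini-F)) (+-comm 1 _)
  where
  cassini-F : Cassini n (fib (2 * suc j ∸ 1))
  cassini-F = subst (λ m → Cassini m _) (sym n≡F) (cassini-fib-2*suc j)

mainTheorem17 : (n : ℕ) → 1 ≤ n →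
    ((Σ ℕ λ h → (1 ≤ h) × DivisibleByLinear (G n 1) (+ h)) ⇔ IsTriangular (n * n))
    × ((Σ ℕ λ h → (1 ≤ h) × DivisibleByLinear (G n 2) (+ h))
         ⇔ (Σ ℕ λ k → (1 ≤ k) × (n ≡ fib (2 * k))))
    × (∀ (h k : ℕ) → 1 ≤ h → DivisibleByLinear (G n 2) (+ h) → 1 ≤ k → n ≡ fib (2 * k)
         → h ≡ fib (2 * k ∸ 1) + 1)
mainTheorem17 n 1≤n = G₁-root⇔triangular n 1≤n , G₂-root⇔evenFib n 1≤n , G₂-root-unique n
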